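{- Every proof in $\mathsf{PA}^\exists$ of a $\Sigma^0_1$ statement $\exists\alpha\,\mathsf P$ (with $\mathsf P$ atomic) can be transformed into a proof of $\exists\alpha\,\mathsf P$ in $\mathsf{HA}^\exists+\mathsf{EM}_1^-$.
   Context: The $\exists$-translation $F^\exists$ leaves atomic formulas, $\wedge,\vee,\to,\exists$ unchanged (recursively) and sets $(\forall xF)^\exists=\neg\exists x\,\neg F^\exists$, with $\neg A:=A\to\bot$. $\mathsf{PA}^\exists$ is the natural-deduction system for arithmetic whose axioms are the $\exists$-translations of the Peano axioms, with the intuitionistic rules for $\wedge,\vee,\to,\exists,\bot$, the translated induction rule (from $\Gamma\vdash A(0)$ and $\Gamma\vdash\neg\exists\alpha\,\neg(A(\alpha)\to A(\mathsf S\alpha))$ infer $\Gamma\vdash\neg\exists\alpha\,\neg A(\alpha)$), and full excluded middle (from $\Gamma,A\vdash C$ and $\Gamma,\neg A\vdash C$ infer $\Gamma\vdash C$). $\mathsf{HA}^\exists$ is the same system without excluded middle (intuitionistic, axioms being $\exists$-translations of the axioms of Heyting Arithmetic). $\mathsf{EM}_1^-$ is the rule: for atomic $\mathsf Q$ and atomic $C$, from $\Gamma,\forall\alpha\mathsf Q\vdash\exists xC$ and $\Gamma,\exists\alpha\mathsf Q^\perp\vdash\exists xC$ infer $\Gamma\vdash\exists xC$, where $\mathsf Q^\perp$ is the atomic complement of $\mathsf Q$. -}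

module Defs where

open import Data.Nat using (ℕ; zero; suc)
open import Data.Fin using (Fin; zero; suc)
open import Data.List using (List; []; _∷_; map)
open import Data.List.Membership.Propositional using (_∈_)
open import Relation.Binary.PropositionalEquality using (_≡_)

infixl 7 _⊗_
infixl 6 _⊕_

data Tm (n : ℕ) : Set where
  var  : Fin n → Tm n
  𝟎    : Tm n
  S    : Tm n → Tm n
  _⊕_  : Tm n → Tm n → Tm n
  _⊗_  : Tm n → Tm n → Tm n

infix 4 _≐_ _≠̇_
data Atom (n : ℕ) : Set where
  _≐_  : Tm n → Tm n → Atom n
  _≠̇_  : Tm n → Tm n → Atom n

_ᶜ : ∀ {n} → Atom n → Atom n
(t ≐ u) ᶜ = t ≠̇ u
(t ≠̇ u) ᶜ = t ≐ u

-- Full language (with ∀), used for the Peano axioms before translation.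
infixr 5 _⇒̇_
infixr 6 _∨̇_
infixr 7 _∧̇_
data Fm (n : ℕ) : Set where
  atom : Atom n → Fm n
  ⊥̇    : Fm n
  _∧̇_  : Fm n → Fm n → Fm n
  _∨̇_  : Fm n → Fm n → Fm n
  _⇒̇_  : Fm n → Fm n → Fm n
  ∃̇    : Fm (suc n) → Fm n
  ∀̇    : Fm (suc n) → Fm n

-- ∀-free formulas: the language of PA^∃ / HA^∃.
infixr 5 _⇒ᵉ_
infixr 6 _∨ᵉ_
infixr 7 _∧ᵉ_
data EFm (n : ℕ) : Set where
  ⌜_⌝   : Atom n → EFm n
  ⊥ᵉ    : EFm n
  _∧ᵉ_  : EFm n → EFm n → EFm n
  _∨ᵉ_  : EFm n → EFm n → EFm n
  _⇒ᵉ_  : EFm n → EFm n → EFm n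
  ∃ᵉ    : EFm (suc n) → EFm n

¬ᵉ_ : ∀ {n} → EFm n → EFm n
¬ᵉ A = A ⇒ᵉ ⊥ᵉ

tr : ∀ {n} → Fm n → EFm n
tr (atom a)  = ⌜ a ⌝
tr ⊥̇         = ⊥ᵉ
tr (A ∧̇ B)   = tr A ∧ᵉ tr B
tr (A ∨̇ B)   = tr A ∨ᵉ tr B
tr (A ⇒̇ B)   = tr A ⇒ᵉ tr B
tr (∃̇ A)     = ∃ᵉ (tr A)
tr (∀̇ A)     = ¬ᵉ (∃ᵉ (¬ᵉ (tr A)))

Ren : ℕ → ℕ → Set
Ren m n = Fin m → Fin n

extR : ∀ {m n} → Ren m n → Ren (suc m) (suc n)
extR ρ zero    = zero
extR ρ (suc i) = suc (ρ i)

renTm : ∀ {m n} → Ren m n → Tm m → Tm n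
renTm ρ (var i)  = var (ρ i)
renTm ρ 𝟎        = 𝟎
renTm ρ (S t)    = S (renTm ρ t)
renTm ρ (t ⊕ u)  = renTm ρ t ⊕ renTm ρ u
renTm ρ (t ⊗ u)  = renTm ρ t ⊗ renTm ρ u

renAt : ∀ {m n} → Ren m n → Atom m → Atom n
renAt ρ (t ≐ u) = renTm ρ t ≐ renTm ρ u
renAt ρ (t ≠̇ u) = renTm ρ t ≠̇ renTm ρ u

renE : ∀ {m n} → Ren m n → EFm m → EFm n
renE ρ ⌜ a ⌝    = ⌜ renAt ρ a ⌝
renE ρ ⊥ᵉ       = ⊥ᵉ
renE ρ (A ∧ᵉ B) = renE ρ A ∧ᵉ renE ρ B
renE ρ (A ∨ᵉ B) = renE ρ A ∨ᵉ renE ρ B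
renE ρ (A ⇒ᵉ B) = renE ρ A ⇒ᵉ renE ρ B
renE ρ (∃ᵉ A)   = ∃ᵉ (renE (extR ρ) A)

Sub : ℕ → ℕ → Set
Sub m n = Fin m → Tm n

extS : ∀ {m n} → Sub m n → Sub (suc m) (suc n)
extS σ zero    = var zero
extS σ (suc i) = renTm suc (σ i)

subTm : ∀ {m n} → Sub m n → Tm m → Tm n
subTm σ (var i)  = σ i
subTm σ 𝟎        = 𝟎
subTm σ (S t)    = S (subTm σ t)
subTm σ (t ⊕ u)  = subTm σ t ⊕ subTm σ u
subTm σ (t ⊗ u)  = subTm σ t ⊗ subTm σ u

subAt : ∀ {m n} → Sub m n → Atom m → Atom n
subAt σ (t ≐ u) = subTm σ t ≐ subTm σ u
subAt σ (t ≠̇ u) = subTm σ t ≠̇ subTm σ u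

subE : ∀ {m n} → Sub m n → EFm m → EFm n
subE σ ⌜ a ⌝    = ⌜ subAt σ a ⌝
subE σ ⊥ᵉ       = ⊥ᵉ
subE σ (A ∧ᵉ B) = subE σ A ∧ᵉ subE σ B
subE σ (A ∨ᵉ B) = subE σ A ∨ᵉ subE σ B
subE σ (A ⇒ᵉ B) = subE σ A ⇒ᵉ subE σ B
subE σ (∃ᵉ A)   = ∃ᵉ (subE (extS σ) A)

-- A[t/α], α the innermost bound variable (de Bruijn index 0)
_[_] : ∀ {n} → EFm (suc n) → Tm n → EFm n
A [ t ] = subE σ A
  where
  σ : Sub (suc _) _
  σ zero    = t
  σ (suc i) = var i

succInst : ∀ {n} → EFm (suc n) → EFm (suc n)
succInst A = subE σ A
  where
  σ : Sub (suc _) (suc _)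
  σ zero    = S (var zero)
  σ (suc i) = var (suc i)

wk : ∀ {n} → EFm n → EFm (suc n)
wk = renE suc

closed : ∀ {n} → EFm 0 → EFm n
closed = renE (λ ())

-- Peano axioms (closed, in the full language); induction is a rule.

private
  v0 : ∀ {n} → Tm (suc n)
  v0 = var zero
  v1 : ∀ {n} → Tm (suc (suc n))
  v1 = var (suc zero)
  v2 : ∀ {n} → Tm (suc (suc (suc n)))
  v2 = var (suc (suc zero))

data PeanoAx : Fm 0 → Set where
  eq-refl   : PeanoAx (∀̇ (atom (v0 ≐ v0)))
  -- x = y → x = z → y = z  (gives symmetry and transitivity)
  eq-eucl   : PeanoAx (∀̇ (∀̇ (∀̇ (atom (v2 ≐ v1) ⇒̇ atom (v2 ≐ v0) ⇒̇ atom (v1 ≐ v0)))))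
  S-cong    : PeanoAx (∀̇ (∀̇ (atom (v1 ≐ v0) ⇒̇ atom (S v1 ≐ S v0))))
  ⊕-congˡ   : PeanoAx (∀̇ (∀̇ (∀̇ (atom (v2 ≐ v1) ⇒̇ atom (v2 ⊕ v0 ≐ v1 ⊕ v0)))))
  ⊕-congʳ   : PeanoAx (∀̇ (∀̇ (∀̇ (atom (v2 ≐ v1) ⇒̇ atom (v0 ⊕ v2 ≐ v0 ⊕ v1)))))
  ⊗-congˡ   : PeanoAx (∀̇ (∀̇ (∀̇ (atom (v2 ≐ v1) ⇒̇ atom (v2 ⊗ v0 ≐ v1 ⊗ v0)))))
  ⊗-congʳ   : PeanoAx (∀̇ (∀̇ (∀̇ (atom (v2 ≐ v1) ⇒̇ atom (v0 ⊗ v2 ≐ v0 ⊗ v1)))))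
  S≢0       : PeanoAx (∀̇ (atom (S v0 ≐ 𝟎) ⇒̇ ⊥̇))
  S-inj     : PeanoAx (∀̇ (∀̇ (atom (S v1 ≐ S v0) ⇒̇ atom (v1 ≐ v0))))
  ⊕-zero    : PeanoAx (∀̇ (atom (v0 ⊕ 𝟎 ≐ v0)))
  ⊕-suc     : PeanoAx (∀̇ (∀̇ (atom (v1 ⊕ S v0 ≐ S (v1 ⊕ v0)))))
  ⊗-zero    : PeanoAx (∀̇ (atom (v0 ⊗ 𝟎 ≐ 𝟎)))
  ⊗-suc     : PeanoAx (∀̇ (∀̇ (atom (v1 ⊗ S v0 ≐ v1 ⊗ v0 ⊕ v1))))
  ≠-elim    : PeanoAx (∀̇ (∀̇ (atom (v1 ≠̇ v0) ⇒̇ atom (v1 ≐ v0) ⇒̇ ⊥̇)))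
  ≠-intro   : PeanoAx (∀̇ (∀̇ ((atom (v1 ≐ v0) ⇒̇ ⊥̇) ⇒̇ atom (v1 ≠̇ v0))))

data System : Set where
  PA∃       : System   -- HA^∃ + full excluded middle
  HA∃+EM₁⁻  : System

Ctx : ℕ → Set
Ctx n = List (EFm n)

infix 2 _⊢[_]_
data _⊢[_]_ : ∀ {n} → Ctx n → System → EFm n → Set where
  hyp   : ∀ {n s} {Γ : Ctx n} {A} → A ∈ Γ → Γ ⊢[ s ] A
  ax    : ∀ {n s} {Γ : Ctx n} {A} → PeanoAx A → Γ ⊢[ s ] closed (tr A)
  ∧I    : ∀ {n s} {Γ : Ctx n} {A B} → Γ ⊢[ s ] A → Γ ⊢[ s ] B → Γ ⊢[ s ] A ∧ᵉ B
  ∧E₁   : ∀ {n s} {Γ : Ctx n} {A B} → Γ ⊢[ s ] A ∧ᵉ B → Γ ⊢[ s ] A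
  ∧E₂   : ∀ {n s} {Γ : Ctx n} {A B} → Γ ⊢[ s ] A ∧ᵉ B → Γ ⊢[ s ] B
  ∨I₁   : ∀ {n s} {Γ : Ctx n} {A B} → Γ ⊢[ s ] A → Γ ⊢[ s ] A ∨ᵉ B
  ∨I₂   : ∀ {n s} {Γ : Ctx n} {A B} → Γ ⊢[ s ] B → Γ ⊢[ s ] A ∨ᵉ B
  ∨E    : ∀ {n s} {Γ : Ctx n} {A B C} → Γ ⊢[ s ] A ∨ᵉ B →
          (A ∷ Γ) ⊢[ s ] C → (B ∷ Γ) ⊢[ s ] C → Γ ⊢[ s ] C
  ⇒I    : ∀ {n s} {Γ : Ctx n} {A B} → (A ∷ Γ) ⊢[ s ] B → Γ ⊢[ s ] A ⇒ᵉ B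
  ⇒E    : ∀ {n s} {Γ : Ctx n} {A B} → Γ ⊢[ s ] A ⇒ᵉ B → Γ ⊢[ s ] A → Γ ⊢[ s ] B
  ⊥E    : ∀ {n s} {Γ : Ctx n} {A} → Γ ⊢[ s ] ⊥ᵉ → Γ ⊢[ s ] A
  ∃I    : ∀ {n s} {Γ : Ctx n} {A} (t : Tm n) → Γ ⊢[ s ] A [ t ] → Γ ⊢[ s ] ∃ᵉ A
  ∃E    : ∀ {n s} {Γ : Ctx n} {A C} → Γ ⊢[ s ] ∃ᵉ A →
          (A ∷ map wk Γ) ⊢[ s ] wk C → Γ ⊢[ s ] C
  -- translated induction rule
  ind   : ∀ {n s} {Γ : Ctx n} {A : EFm (suc n)} →
          Γ ⊢[ s ] A [ 𝟎 ] →
          Γ ⊢[ s ] ¬ᵉ ∃ᵉ (¬ᵉ (A ⇒ᵉ succInst A)) →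
          Γ ⊢[ s ] ¬ᵉ ∃ᵉ (¬ᵉ A)
  em    : ∀ {n s} {Γ : Ctx n} {A C} → s ≡ PA∃ →
          (A ∷ Γ) ⊢[ s ] C → ((¬ᵉ A) ∷ Γ) ⊢[ s ] C → Γ ⊢[ s ] C
  -- EM₁⁻ (HA^∃ + EM₁⁻ only); ∀αQ is the hypothesis (∀αQ)^∃
  em₁⁻  : ∀ {n s} {Γ : Ctx n} (Q C : Atom (suc n)) → s ≡ HA∃+EM₁⁻ →
          (tr (∀̇ (atom Q)) ∷ Γ) ⊢[ s ] ∃ᵉ ⌜ C ⌝ →
          (∃ᵉ ⌜ Q ᶜ ⌝ ∷ Γ) ⊢[ s ] ∃ᵉ ⌜ C ⌝ →
          Γ ⊢[ s ] ∃ᵉ ⌜ C ⌝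

-- Classical derivations are turned into intuitionistic ones by double negation
-- (Glivenko): the ∃-translation has no ∀, so ⊢ A in PA^∃ gives ⊢ ¬¬A in HA^∃,
-- the induction rule surviving because ¬∃¬A and ¬∃¬¬¬A are interderivable.  For
-- A = ∃α P, apply EM₁⁻ to Q = P^⊥: under ∀α P^⊥ the formula ∃α P is refutable,
-- contradicting ¬¬∃α P, while ∃α P^⊥^⊥ is literally ∃α P.
module Submission where

open import Defs
open import Data.Nat using (ℕ; zero; suc)
open import Data.Fin using (zero; suc)
open import Data.List using ([]; _∷_; map)
open import Data.List.Relation.Binary.Subset.Propositional using (_⊆_)
open import Data.List.Relation.Binary.Subset.Propositional.Properties using (∷⁺ʳ; map⁺)
open import Data.List.Relation.Unary.Any using (here; there)
open import Relation.Binary.PropositionalEquality using (_≡_; refl; sym; cong; cong₂; subst)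

private
  variable
    n m : ℕ
    s : System
    Γ Δ : Ctx n
    A B C : EFm n

ᶜ-involutive : (a : Atom n) → a ᶜ ᶜ ≡ a
ᶜ-involutive (t ≐ u) = refl
ᶜ-involutive (t ≠̇ u) = refl

subTm-renTm-cancel : (σ : Sub m n) (ρ : Ren n m) → (∀ i → σ (ρ i) ≡ var i) →
                     ∀ t → subTm σ (renTm ρ t) ≡ t
subTm-renTm-cancel σ ρ σρ≗var (var i) = σρ≗var i
subTm-renTm-cancel σ ρ σρ≗var 𝟎       = refl
subTm-renTm-cancel σ ρ σρ≗var (S t)   = cong S (subTm-renTm-cancel σ ρ σρ≗var t)
subTm-renTm-cancel σ ρ σρ≗var (t ⊕ u) =
  cong₂ _⊕_ (subTm-renTm-cancel σ ρ σρ≗var t) (subTm-renTm-cancel σ ρ σρ≗var u)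
subTm-renTm-cancel σ ρ σρ≗var (t ⊗ u) =
  cong₂ _⊗_ (subTm-renTm-cancel σ ρ σρ≗var t) (subTm-renTm-cancel σ ρ σρ≗var u)

subAt-renAt-cancel : (σ : Sub m n) (ρ : Ren n m) → (∀ i → σ (ρ i) ≡ var i) →
                     ∀ a → subAt σ (renAt ρ a) ≡ a
subAt-renAt-cancel σ ρ σρ≗var (t ≐ u) =
  cong₂ _≐_ (subTm-renTm-cancel σ ρ σρ≗var t) (subTm-renTm-cancel σ ρ σρ≗var u)
subAt-renAt-cancel σ ρ σρ≗var (t ≠̇ u) =
  cong₂ _≠̇_ (subTm-renTm-cancel σ ρ σρ≗var t) (subTm-renTm-cancel σ ρ σρ≗var u)

subE-renE-cancel : (σ : Sub m n) (ρ : Ren n m) → (∀ i → σ (ρ i) ≡ var i) →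
                   ∀ A → subE σ (renE ρ A) ≡ A
subE-renE-cancel σ ρ σρ≗var ⌜ a ⌝    = cong ⌜_⌝ (subAt-renAt-cancel σ ρ σρ≗var a)
subE-renE-cancel σ ρ σρ≗var ⊥ᵉ       = refl
subE-renE-cancel σ ρ σρ≗var (A ∧ᵉ B) =
  cong₂ _∧ᵉ_ (subE-renE-cancel σ ρ σρ≗var A) (subE-renE-cancel σ ρ σρ≗var B)
subE-renE-cancel σ ρ σρ≗var (A ∨ᵉ B) =
  cong₂ _∨ᵉ_ (subE-renE-cancel σ ρ σρ≗var A) (subE-renE-cancel σ ρ σρ≗var B)
subE-renE-cancel σ ρ σρ≗var (A ⇒ᵉ B) =
  cong₂ _⇒ᵉ_ (subE-renE-cancel σ ρ σρ≗var A) (subE-renE-cancel σ ρ σρ≗var B)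
subE-renE-cancel σ ρ σρ≗var (∃ᵉ A)   =
  cong ∃ᵉ (subE-renE-cancel (extS σ) (extR ρ) extSσ-extRρ≗var A)
  where
  extSσ-extRρ≗var : ∀ i → extS σ (extR ρ i) ≡ var i
  extSσ-extRρ≗var zero    = refl
  extSσ-extRρ≗var (suc i) = cong (renTm suc) (σρ≗var i)

wk-body-inst : (B : EFm (suc n)) → renE (extR suc) B [ var zero ] ≡ B
wk-body-inst B = subE-renE-cancel _ (extR suc) (λ { zero → refl ; (suc i) → refl }) B

weaken : Γ ⊆ Δ → Γ ⊢[ s ] A → Δ ⊢[ s ] A
weaken Γ⊆Δ (hyp A∈Γ)        = hyp (Γ⊆Δ A∈Γ)
weaken Γ⊆Δ (ax a)           = ax a
weaken Γ⊆Δ (∧I d e)         = ∧I (weaken Γ⊆Δ d) (weaken Γ⊆Δ e)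
weaken Γ⊆Δ (∧E₁ d)          = ∧E₁ (weaken Γ⊆Δ d)
weaken Γ⊆Δ (∧E₂ d)          = ∧E₂ (weaken Γ⊆Δ d)
weaken Γ⊆Δ (∨I₁ d)          = ∨I₁ (weaken Γ⊆Δ d)
weaken Γ⊆Δ (∨I₂ d)          = ∨I₂ (weaken Γ⊆Δ d)
weaken Γ⊆Δ (∨E d e f)       = ∨E (weaken Γ⊆Δ d) (weaken (∷⁺ʳ _ Γ⊆Δ) e) (weaken (∷⁺ʳ _ Γ⊆Δ) f)
weaken Γ⊆Δ (⇒I d)           = ⇒I (weaken (∷⁺ʳ _ Γ⊆Δ) d)
weaken Γ⊆Δ (⇒E d e)         = ⇒E (weaken Γ⊆Δ d) (weaken Γ⊆Δ e)
weaken Γ⊆Δ (⊥E d)           = ⊥E (weaken Γ⊆Δ d)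
weaken Γ⊆Δ (∃I t d)         = ∃I t (weaken Γ⊆Δ d)
weaken Γ⊆Δ (∃E d e)         = ∃E (weaken Γ⊆Δ d) (weaken (∷⁺ʳ _ (map⁺ wk Γ⊆Δ)) e)
weaken Γ⊆Δ (ind d e)        = ind (weaken Γ⊆Δ d) (weaken Γ⊆Δ e)
weaken Γ⊆Δ (em eq d e)      = em eq (weaken (∷⁺ʳ _ Γ⊆Δ) d) (weaken (∷⁺ʳ _ Γ⊆Δ) e)
weaken Γ⊆Δ (em₁⁻ Q C eq d e) = em₁⁻ Q C eq (weaken (∷⁺ʳ _ Γ⊆Δ) d) (weaken (∷⁺ʳ _ Γ⊆Δ) e)

weaken₁ : Γ ⊢[ s ] A → (B ∷ Γ) ⊢[ s ] A
weaken₁ = weaken there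

weaken-under₁ : (A ∷ Γ) ⊢[ s ] C → (A ∷ B ∷ Γ) ⊢[ s ] C
weaken-under₁ = weaken (∷⁺ʳ _ there)

hyp₀ : (A ∷ Γ) ⊢[ s ] A
hyp₀ = hyp (here refl)

hyp₁ : (B ∷ A ∷ Γ) ⊢[ s ] A
hyp₁ = hyp (there (here refl))

hyp₂ : (C ∷ B ∷ A ∷ Γ) ⊢[ s ] A
hyp₂ = hyp (there (there (here refl)))

contrapose : (A ∷ Γ) ⊢[ s ] B → (¬ᵉ B ∷ Γ) ⊢[ s ] ¬ᵉ A
contrapose d = ⇒I (⇒E hyp₁ (weaken-under₁ d))

∃I-fresh : {B : EFm (suc n)} → Δ ⊢[ s ] B → Δ ⊢[ s ] ∃ᵉ (renE (extR suc) B)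
∃I-fresh {B = B} d = ∃I (var zero) (subst (_ ⊢[ _ ]_) (sym (wk-body-inst B)) d)

∃-map : Γ ⊢[ s ] ∃ᵉ A → (A ∷ map wk Γ) ⊢[ s ] B → Γ ⊢[ s ] ∃ᵉ B
∃-map d e = ∃E d (∃I-fresh e)

¬∃-contramap : (A ∷ map wk Γ) ⊢[ s ] B → Γ ⊢[ s ] ¬ᵉ ∃ᵉ B → Γ ⊢[ s ] ¬ᵉ ∃ᵉ A
¬∃-contramap d ¬∃B = ⇒I (⇒E (weaken₁ ¬∃B) (∃-map hyp₀ (weaken-under₁ d)))

¬∃¬-inst : Γ ⊢[ s ] ¬ᵉ ∃ᵉ (¬ᵉ A) → (t : Tm _) → Γ ⊢[ s ] ¬ᵉ ¬ᵉ (A [ t ])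
¬∃¬-inst d t = ⇒I (⇒E (weaken₁ d) (∃I t hyp₀))

¬¬-pure : Γ ⊢[ s ] A → Γ ⊢[ s ] ¬ᵉ ¬ᵉ A
¬¬-pure d = ⇒I (⇒E hyp₀ (weaken₁ d))

¬¬-bind : Γ ⊢[ s ] ¬ᵉ ¬ᵉ A → (A ∷ Γ) ⊢[ s ] ¬ᵉ ¬ᵉ B → Γ ⊢[ s ] ¬ᵉ ¬ᵉ B
¬¬-bind d e = ⇒I (⇒E (weaken₁ d) (⇒I (⇒E (weaken-under₁ e) hyp₁)))

¬¬-map : Γ ⊢[ s ] ¬ᵉ ¬ᵉ A → (A ∷ Γ) ⊢[ s ] B → Γ ⊢[ s ] ¬ᵉ ¬ᵉ B
¬¬-map d e = ¬¬-bind d (¬¬-pure e)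

¬¬-map₂ : Γ ⊢[ s ] ¬ᵉ ¬ᵉ A → Γ ⊢[ s ] ¬ᵉ ¬ᵉ B → (B ∷ A ∷ Γ) ⊢[ s ] C → Γ ⊢[ s ] ¬ᵉ ¬ᵉ C
¬¬-map₂ d e f = ¬¬-bind d (¬¬-map (weaken₁ e) f)

¬¬¬⇒¬ : Γ ⊢[ s ] ¬ᵉ ¬ᵉ ¬ᵉ A → Γ ⊢[ s ] ¬ᵉ A
¬¬¬⇒¬ d = ⇒I (⇒E (weaken₁ d) (¬¬-pure hyp₀))

¬¬-⇒I : (A ∷ Γ) ⊢[ s ] ¬ᵉ ¬ᵉ B → Γ ⊢[ s ] ¬ᵉ ¬ᵉ (A ⇒ᵉ B)
¬¬-⇒I d = ⇒I (⇒E hyp₀ (⇒I (⊥E (⇒E (weaken-under₁ d) (weaken₁ (contrapose (⇒I hyp₁)))))))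

¬¬-em : (A ∷ Γ) ⊢[ s ] ¬ᵉ ¬ᵉ C → (¬ᵉ A ∷ Γ) ⊢[ s ] ¬ᵉ ¬ᵉ C → Γ ⊢[ s ] ¬ᵉ ¬ᵉ C
¬¬-em d e = ⇒I (⇒E (⇒E (weaken₁ (⇒I e)) (⇒I (⇒E (weaken-under₁ d) hyp₁))) hyp₀)

-- Induction is applied to ¬¬A, whose step ¬¬A ⇒ ¬¬A(Sα) follows from A ⇒ A(Sα).
¬¬-ind : {A : EFm (suc n)} →
         Γ ⊢[ s ] ¬ᵉ ¬ᵉ (A [ 𝟎 ]) →
         Γ ⊢[ s ] ¬ᵉ ∃ᵉ (¬ᵉ (A ⇒ᵉ succInst A)) →
         Γ ⊢[ s ] ¬ᵉ ∃ᵉ (¬ᵉ A)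
¬¬-ind base step =
  ¬∃-contramap (¬¬-pure hyp₀) (ind base (¬∃-contramap (contrapose ¬¬-step) step))
  where
  ¬¬-step : ((A ⇒ᵉ B) ∷ Δ) ⊢[ s ] ¬ᵉ ¬ᵉ A ⇒ᵉ ¬ᵉ ¬ᵉ B
  ¬¬-step = ⇒I (¬¬-map hyp₀ (⇒E hyp₂ hyp₀))

glivenko : Γ ⊢[ PA∃ ] A → Γ ⊢[ s ] ¬ᵉ ¬ᵉ A
glivenko (hyp A∈Γ)         = ¬¬-pure (hyp A∈Γ)
glivenko (ax a)            = ¬¬-pure (ax a)
glivenko (∧I d e)          = ¬¬-map₂ (glivenko d) (glivenko e) (∧I hyp₁ hyp₀)
glivenko (∧E₁ d)           = ¬¬-map (glivenko d) (∧E₁ hyp₀)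
glivenko (∧E₂ d)           = ¬¬-map (glivenko d) (∧E₂ hyp₀)
glivenko (∨I₁ d)           = ¬¬-map (glivenko d) (∨I₁ hyp₀)
glivenko (∨I₂ d)           = ¬¬-map (glivenko d) (∨I₂ hyp₀)
glivenko (∨E d e f)        =
  ¬¬-bind (glivenko d) (∨E hyp₀ (weaken-under₁ (glivenko e)) (weaken-under₁ (glivenko f)))
glivenko (⇒I d)            = ¬¬-⇒I (glivenko d)
glivenko (⇒E d e)          = ¬¬-map₂ (glivenko d) (glivenko e) (⇒E hyp₁ hyp₀)
glivenko (⊥E d)            = ¬¬-bind (glivenko d) (⊥E hyp₀)
glivenko (∃I t d)          = ¬¬-map (glivenko d) (∃I t hyp₀)
glivenko (∃E d e)          = ¬¬-bind (glivenko d) (∃E hyp₀ (weaken-under₁ (glivenko e)))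
glivenko (ind d e)         = ¬¬-pure (¬¬-ind (glivenko d) (¬¬¬⇒¬ (glivenko e)))
glivenko (em _ d e)        = ¬¬-em (glivenko d) (glivenko e)
glivenko (em₁⁻ Q C () d e)

≠-elimᵉ : (t u : Tm n) → Γ ⊢[ s ] ⌜ t ≠̇ u ⌝ → Γ ⊢[ s ] ⌜ t ≐ u ⌝ → Γ ⊢[ s ] ⊥ᵉ
≠-elimᵉ {Γ = Γ} {s = s} t u t≠u t≐u =
  ⇒E ¬¬≠-elim (⇒I (⇒E (⇒E hyp₀ (weaken₁ t≠u)) (weaken₁ t≐u)))
  where
  -- Instantiating the outer variable of the axiom leaves t weakened under the
  -- inner binder; the substitution for u undoes that weakening.
  ¬¬≠-elim : Γ ⊢[ s ] ¬ᵉ ¬ᵉ (⌜ t ≠̇ u ⌝ ⇒ᵉ ⌜ t ≐ u ⌝ ⇒ᵉ ⊥ᵉ)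
  ¬¬≠-elim = subst (λ T → Γ ⊢[ s ] ¬ᵉ ¬ᵉ (⌜ T ≠̇ u ⌝ ⇒ᵉ ⌜ T ≐ u ⌝ ⇒ᵉ ⊥ᵉ))
    (subTm-renTm-cancel _ suc (λ _ → refl) t)
    (¬∃¬-inst (¬¬¬⇒¬ (¬∃¬-inst (ax ≠-elim) t)) u)

ᶜ-elim : (a : Atom n) → Γ ⊢[ s ] ⌜ a ᶜ ⌝ → Γ ⊢[ s ] ⌜ a ⌝ → Γ ⊢[ s ] ⊥ᵉ
ᶜ-elim (t ≐ u) aᶜ a = ≠-elimᵉ t u aᶜ a
ᶜ-elim (t ≠̇ u) aᶜ a = ≠-elimᵉ t u a aᶜ

∀ᶜ⇒¬∃ : (a : Atom (suc n)) → Γ ⊢[ s ] tr (∀̇ (atom (a ᶜ))) ⇒ᵉ ¬ᵉ ∃ᵉ ⌜ a ⌝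
∀ᶜ⇒¬∃ a = ⇒I (⇒I (∃E hyp₀ (⇒E hyp₂ (∃I-fresh (⇒I (ᶜ-elim a hyp₀ hyp₁))))))

mainTheorem11 : (P : Atom 1) →
    [] ⊢[ PA∃ ] ∃ᵉ ⌜ P ⌝ → [] ⊢[ HA∃+EM₁⁻ ] ∃ᵉ ⌜ P ⌝
mainTheorem11 P d = em₁⁻ (P ᶜ) P refl refuted-by-∀Pᶜ from-∃Pᶜᶜ
  where
  refuted-by-∀Pᶜ : (tr (∀̇ (atom (P ᶜ))) ∷ []) ⊢[ HA∃+EM₁⁻ ] ∃ᵉ ⌜ P ⌝
  refuted-by-∀Pᶜ = ⊥E (⇒E (weaken₁ (glivenko d)) (⇒E (∀ᶜ⇒¬∃ P) hyp₀))
  from-∃Pᶜᶜ : (∃ᵉ ⌜ P ᶜ ᶜ ⌝ ∷ []) ⊢[ HA∃+EM₁⁻ ] ∃ᵉ ⌜ P ⌝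
  from-∃Pᶜᶜ rewrite ᶜ-involutive P = hyp₀
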